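{- Let $G$ be a complete bipartite graph with vertex classes $X$ and $Y$, and let the edges of $G$ be colored with colors $1,2$. For $i\in[2]$ let $G_i$ be the spanning subgraph of $G$ consisting of the edges of color $i$. Then one of the following holds: (P1) There exist $x_1,x_2\in X$ such that every edge incident with $x_i$ has color $i$ ($i=1,2$), or there exist $y_1,y_2\in Y$ such that every edge incident with $y_i$ has color $i$ ($i=1,2$). In this case, for each $i\in[2]$, $V(G)$ can be covered by a tree of color $i$ of diameter at most $3$ together with a tree of color $3-i$ of diameter at most $2$. (P2) There are partitions $\{X_1,X_2\}$ of $X$ and $\{Y_1,Y_2\}$ of $Y$ such that $[X_1,Y_1]\cup[X_2,Y_2]=G_1$ and $[X_1,Y_2]\cup[X_2,Y_1]=G_2$. In this case, for each $i\in[2]$, $V(G)$ can be covered by two trees of color $i$, each of diameter at most $3$. (P3) There exists $i\in[2]$ such that $G_i$ has diameter at most $6$, and $V(G)$ can be covered by at most two monochromatic trees each of diameter at most $4$.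
   Context: For disjoint vertex sets $A,B$, $[A,B]$ denotes the complete bipartite graph with parts $A$ and $B$. A tree of color $i$ is a subgraph which is a tree all of whose edges have color $i$. The diameter of a connected graph is the maximum distance between two of its vertices. -}

module Defs where

open import Data.Nat using (ℕ; zero; suc; _≤_)
open import Data.Fin using (Fin; zero; suc)
open import Data.Fin.Properties using (_≟_)
open import Data.Bool using (Bool; true; false)
open import Data.Sum using (_⊎_; inj₁; inj₂)
open import Data.Product using (Σ; ∃; ∃₂; _×_; _,_)
open import Data.Empty using (⊥)
open import Data.List using (List; []; _∷_; _++_; [_]; length)
open import Data.List.Relation.Unary.Linked using (Linked)
open import Data.List.Relation.Unary.Unique.Propositional using (Unique)
open import Relation.Nullary using (¬_)
open import Relation.Nullary.Decidable using (⌊_⌋)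
open import Relation.Binary.PropositionalEquality using (_≡_; _≢_)

Colour : Set
Colour = Fin 2

c₁ c₂ : Colour
c₁ = zero
c₂ = suc zero

opp : Colour → Colour
opp zero = suc zero
opp (suc _) = zero

-- Vertices of the complete bipartite graph with classes X = Fin m, Y = Fin n.
V : ℕ → ℕ → Set
V m n = Fin m ⊎ Fin n

Colouring : ℕ → ℕ → Set
Colouring m n = Fin m → Fin n → Colour

record Subgraph (m n : ℕ) : Set where
  field
    vert : V m n → Bool
    edge : Fin m → Fin n → Bool
    edge-ok : ∀ x y → edge x y ≡ true → (vert (inj₁ x) ≡ true) × (vert (inj₂ y) ≡ true)
open Subgraph public

module _ {m n : ℕ} (H : Subgraph m n) where

  Adj : V m n → V m n → Set
  Adj (inj₁ x) (inj₂ y) = edge H x y ≡ true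
  Adj (inj₂ y) (inj₁ x) = edge H x y ≡ true
  Adj _ _ = ⊥

  data Walk : V m n → V m n → ℕ → Set where
    nil  : ∀ {u} → Walk u u zero
    cons : ∀ {u w v k} → Adj u w → Walk w v k → Walk u v (suc k)

  InH : V m n → Set
  InH v = vert H v ≡ true

  Connected : Set
  Connected = ∀ u v → InH u → InH v → ∃ λ k → Walk u v k

  HasCycle : Set
  HasCycle = Σ (V m n) λ v → Σ (List (V m n)) λ ws →
    (2 ≤ length ws) × Unique (v ∷ ws) × Linked Adj (v ∷ ws ++ [ v ])

  IsTree : Set
  IsTree = (∃ λ v → InH v) × Connected × ¬ HasCycle

  DiamLE : ℕ → Set
  DiamLE d = ∀ u v → InH u → InH v → ∃ λ k → (k ≤ d) × Walk u v k

HasColour : ∀ {m n} → Colouring m n → Colour → Subgraph m n → Set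
HasColour c i H = ∀ x y → edge H x y ≡ true → c x y ≡ i

MonoTree : ∀ {m n} → Colouring m n → Colour → ℕ → Subgraph m n → Set
MonoTree c i d H = HasColour c i H × IsTree H × DiamLE H d

Covers₂ : ∀ {m n} → Subgraph m n → Subgraph m n → Set
Covers₂ {m} {n} T U = ∀ (v : V m n) → (vert T v ≡ true) ⊎ (vert U v ≡ true)

Covers₁ : ∀ {m n} → Subgraph m n → Set
Covers₁ {m} {n} T = ∀ (v : V m n) → vert T v ≡ true

colourGraph : ∀ {m n} → Colouring m n → Colour → Subgraph m n
colourGraph c i = record
  { vert = λ _ → true
  ; edge = λ x y → ⌊ c x y ≟ i ⌋
  ; edge-ok = λ _ _ _ → _≡_.refl , _≡_.refl }

P1 : ∀ {m n} → Colouring m n → Set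
P1 {m} {n} c =
  (∃₂ λ (x₁ x₂ : Fin m) → (∀ y → c x₁ y ≡ c₁) × (∀ y → c x₂ y ≡ c₂))
  ⊎ (∃₂ λ (y₁ y₂ : Fin n) → (∀ x → c x y₁ ≡ c₁) × (∀ x → c x y₂ ≡ c₂))

-- (P2) condition: partitions given by part-labels px : X → Fin 2, py : Y → Fin 2
-- (X₁ = px⁻¹(zero), X₂ = px⁻¹(suc zero), all four parts nonempty);
-- colour-1 edges are exactly [X₁,Y₁] ∪ [X₂,Y₂], colour-2 edges exactly [X₁,Y₂] ∪ [X₂,Y₁].
P2 : ∀ {m n} → Colouring m n → Set
P2 {m} {n} c = Σ (Fin m → Fin 2) λ px → Σ (Fin n → Fin 2) λ py →
  (∀ (j : Fin 2) → ∃ λ x → px x ≡ j) × (∀ (j : Fin 2) → ∃ λ y → py y ≡ j) ×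
  (∀ x y → (c x y ≡ c₁ → px x ≡ py y) × (px x ≡ py y → c x y ≡ c₁)) ×
  (∀ x y → (c x y ≡ c₂ → px x ≢ py y) × (px x ≢ py y → c x y ≡ c₂))

-- Under (P1), a double star through the line of colour i and a star through the line
-- (or a vertex) of the other colour do the job. Otherwise a row entirely of colour 2
-- is within distance 2 of every vertex of G₂; if there is none, every vertex has a
-- colour-1 edge, and either any two vertices of the same class are at distance ≤ 4 in
-- G₁ (so G₁ has diameter ≤ 6), or some x, x' are farther apart. Then a case analysis
-- on how the colour-1 neighbourhoods of x, x' and the vertices meeting them interlock
-- yields a vertex within distance 3 of everything in G₂, or else the partition of
-- (P2); its four blocks are monochromatic complete bipartite graphs, each spanned by a
-- double star.
-- The two trees of diameter ≤ 4 are depth-two breadth-first trees: at a row x₀ in both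
-- colours if every row agrees with x₀ somewhere, and otherwise in one colour at x₀ and
-- at its complementary row, that colour being one used by every row, which exists
-- unless (P1) holds.

module Submission where

open import Defs
open import Level using (0ℓ)
open import Data.Nat using (ℕ; suc; _≤_; _+_; z≤n; s≤s)
open import Data.Nat.Properties using (+-comm; +-mono-≤; ≤-refl; ≤-trans; m≤m+n)
open import Data.Fin using (Fin; zero; suc)
open import Data.Fin.Properties using (_≟_; any?; all?; ¬∀⟶∃¬)
open import Data.Bool using (true)
open import Data.Unit using (tt)
open import Data.Sum using (_⊎_; inj₁; inj₂; [_,_]′; swap)
open import Data.Product using (Σ; ∃; ∃₂; _×_; _,_; proj₁; proj₂)
open import Data.Empty using (⊥; ⊥-elim)
open import Data.List using ([]; _∷_; _++_; [_])
open import Data.List.Relation.Unary.Linked using (Linked; [-]; _∷_)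
open import Data.List.Relation.Unary.AllPairs using (_∷_)
open import Data.List.Relation.Unary.All using (All; []; _∷_)
open import Function using (_∘_; id; const)
open import Relation.Nullary using (¬_; Dec; yes; no)
open import Relation.Nullary.Decidable using (⌊_⌋; _×-dec_; _⊎-dec_; ¬?; ⊥-dec)
open import Relation.Unary using (Pred; Decidable)
open import Relation.Binary.PropositionalEquality using (_≡_; _≢_; refl; sym; trans; cong; subst; ≢-sym)

witness⇒⌊⌋ : ∀ {p} {P : Set p} (P? : Dec P) → P → ⌊ P? ⌋ ≡ true
witness⇒⌊⌋ (yes _) _ = refl
witness⇒⌊⌋ (no ¬p) p = ⊥-elim (¬p p)

⌊⌋⇒witness : ∀ {p} {P : Set p} (P? : Dec P) → ⌊ P? ⌋ ≡ true → P
⌊⌋⇒witness (yes p) _ = p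
⌊⌋⇒witness (no _) ()

dec-⊎ : ∀ {a b} {A : Set a} {B : Set b} → Dec A → Dec B → ¬ (¬ A × ¬ B) → A ⊎ B
dec-⊎ (yes a) _ _ = inj₁ a
dec-⊎ (no _) (yes b) _ = inj₂ b
dec-⊎ (no ¬a) (no ¬b) ¬both = ⊥-elim (¬both (¬a , ¬b))

opp-≢ : ∀ i → opp i ≢ i
opp-≢ zero ()
opp-≢ (suc zero) ()

opp⇒≢ : ∀ {a i} → a ≡ opp i → a ≢ i
opp⇒≢ {i = i} a≡opp a≡i = opp-≢ i (trans (sym a≡opp) a≡i)

≢⇒≡opp : ∀ {a i : Colour} → a ≢ i → a ≡ opp i
≢⇒≡opp {zero} {zero} a≢i = ⊥-elim (a≢i refl)
≢⇒≡opp {zero} {suc zero} _ = refl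
≢⇒≡opp {suc zero} {zero} _ = refl
≢⇒≡opp {suc zero} {suc zero} a≢i = ⊥-elim (a≢i refl)

≢opp⇒≡ : ∀ {a i : Colour} → a ≢ opp i → a ≡ i
≢opp⇒≡ {zero} {zero} _ = refl
≢opp⇒≡ {zero} {suc zero} a≢ = ⊥-elim (a≢ refl)
≢opp⇒≡ {suc zero} {zero} a≢ = ⊥-elim (a≢ refl)
≢opp⇒≡ {suc zero} {suc zero} _ = refl

≡⊎≡opp : ∀ (a i : Colour) → a ≡ i ⊎ a ≡ opp i
≡⊎≡opp a i with a ≟ i
... | yes a≡i = inj₁ a≡i
... | no a≢i = inj₂ (≢⇒≡opp a≢i)

module _ {m n : ℕ} (H : Subgraph m n) where

  Adj-sym : ∀ {u v} → Adj H u v → Adj H v u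
  Adj-sym {inj₁ _} {inj₂ _} a = a
  Adj-sym {inj₂ _} {inj₁ _} a = a
  Adj-sym {inj₁ _} {inj₁ _} ()
  Adj-sym {inj₂ _} {inj₂ _} ()

  Within : ℕ → V m n → V m n → Set
  Within d u v = ∃ λ k → k ≤ d × Walk H u v k

_++ʷ_ : ∀ {m n} {H : Subgraph m n} {u v w k l} → Walk H u v k → Walk H v w l → Walk H u w (k + l)
nil ++ʷ q = q
cons a p ++ʷ q = cons a (p ++ʷ q)

reverseʷ : ∀ {m n} {H : Subgraph m n} {u v k} → Walk H u v k → Walk H v u k
reverseʷ nil = nil
reverseʷ {H = H} {k = suc k} (cons a p) =
  subst (Walk H _ _) (+-comm k 1) (reverseʷ p ++ʷ cons (Adj-sym H a) nil)

module _ {m n : ℕ} {H : Subgraph m n} where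

  Within-sym : ∀ {d u v} → Within H d u v → Within H d v u
  Within-sym (k , k≤d , p) = k , k≤d , reverseʷ p

  Within-weaken : ∀ {d d' u v} → d ≤ d' → Within H d u v → Within H d' u v
  Within-weaken d≤d' (k , k≤d , p) = k , ≤-trans k≤d d≤d' , p

  Within-snoc : ∀ {d u v w} → Within H d u v → Adj H v w → Within H (d + 1) u w
  Within-snoc (k , k≤d , p) a = k + 1 , +-mono-≤ k≤d ≤-refl , p ++ʷ cons a nil

module _ {m n : ℕ} (H : Subgraph m n) where

  radius⇒diam : ∀ v b → (∀ u → InH H u → Within H b u v) → DiamLE H (b + b)
  radius⇒diam v b toV u w hu hw with toV u hu | toV w hw
  ... | k , k≤b , p | l , l≤b , q = k + l , +-mono-≤ k≤b l≤b , p ++ʷ reverseʷ q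

  DiamLE⇒Connected : ∀ {d} → DiamLE H d → Connected H
  DiamLE⇒Connected diam u v hu hv with diam u v hu hv
  ... | k , _ , p = k , p

  doubleStar⇒diam3 : ∀ r y₀ → edge H r y₀ ≡ true →
    (∀ x → InH H (inj₁ x) → edge H x y₀ ≡ true) →
    (∀ y → InH H (inj₂ y) → edge H r y ≡ true) → DiamLE H 3
  doubleStar⇒diam3 r y₀ r~y₀ to-y₀ to-r (inj₁ x) (inj₁ x') hu hv =
    2 , s≤s (s≤s z≤n) , cons {w = inj₂ y₀} (to-y₀ x hu) (cons (to-y₀ x' hv) nil)
  doubleStar⇒diam3 r y₀ r~y₀ to-y₀ to-r (inj₂ y) (inj₂ y') hu hv =
    2 , s≤s (s≤s z≤n) , cons {w = inj₁ r} (to-r y hu) (cons (to-r y' hv) nil)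
  doubleStar⇒diam3 r y₀ r~y₀ to-y₀ to-r (inj₁ x) (inj₂ y) hu hv =
    3 , ≤-refl , cons {w = inj₂ y₀} (to-y₀ x hu) (cons {w = inj₁ r} r~y₀ (cons (to-r y hv) nil))
  doubleStar⇒diam3 r y₀ r~y₀ to-y₀ to-r (inj₂ y) (inj₁ x) hu hv =
    3 , ≤-refl , cons {w = inj₁ r} (to-r y hu) (cons {w = inj₂ y₀} r~y₀ (cons (to-y₀ x hv) nil))

-- A cycle alternates between X and Y and so contains two X-vertices, one of them
-- different from r; on the cycle it has two distinct neighbours.
module _ {m n : ℕ} (H : Subgraph m n) (r : Fin m)
  (one-neighbour : ∀ {x y y'} → x ≢ r → edge H x y ≡ true → edge H x y' ≡ true → y ≡ y') where

  private
    neighbour-unique : ∀ {x a b} → x ≢ r → Adj H (inj₁ x) a → Adj H (inj₁ x) b → a ≡ b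
    neighbour-unique {a = inj₂ _} {inj₂ _} x≢r p q = cong inj₂ (one-neighbour x≢r p q)
    neighbour-unique {a = inj₁ _} _ () _
    neighbour-unique {a = inj₂ _} {inj₁ _} _ _ ()

    entered-from : ∀ {x a v} L → x ≢ r → Adj H a (inj₁ x) → a ≢ v → All (a ≢_) L →
                   Linked (Adj H) (inj₁ x ∷ L ++ [ v ]) → ⊥
    entered-from [] x≢r a~x a≢v _ (x~v ∷ _) =
      a≢v (neighbour-unique x≢r (Adj-sym H a~x) x~v)
    entered-from (_ ∷ _) x≢r a~x _ (a≢w ∷ _) (x~w ∷ _) =
      a≢w (neighbour-unique x≢r (Adj-sym H a~x) x~w)

  noCycle : ¬ HasCycle H
  noCycle (_ , [] , () , _)
  noCycle (_ , _ ∷ [] , s≤s () , _)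
  noCycle (inj₁ a , inj₂ b ∷ inj₁ d ∷ rest , _ ,
           (a≢b ∷ _) ∷ (_ ∷ b≢rest) ∷ _ , _ ∷ b~d ∷ d~rest) with d ≟ r
  ... | no d≢r = entered-from rest d≢r b~d (≢-sym a≢b) b≢rest d~rest
  noCycle (inj₁ a , inj₂ b ∷ inj₁ d ∷ [] , _ , _ , _ ∷ _ ∷ () ∷ _) | yes refl
  noCycle (inj₁ a , inj₂ b ∷ inj₁ d ∷ w ∷ [] , _ ,
           (_ ∷ a≢d ∷ _) ∷ (_ ∷ b≢w ∷ []) ∷ _ , a~b ∷ _ ∷ _ ∷ w~a ∷ [-]) | yes refl =
    b≢w (neighbour-unique (a≢d ∘ cong inj₁) a~b (Adj-sym H w~a))
  noCycle (inj₁ a , inj₂ b ∷ inj₁ d ∷ inj₁ _ ∷ _ ∷ _ , _ , _ , _ ∷ _ ∷ () ∷ _) | yes refl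
  noCycle (inj₁ a , inj₂ b ∷ inj₁ d ∷ inj₂ _ ∷ inj₂ _ ∷ _ , _ , _ , _ ∷ _ ∷ _ ∷ () ∷ _) | yes refl
  noCycle (inj₁ a , inj₂ b ∷ inj₁ d ∷ inj₂ w ∷ inj₁ e ∷ rest , _ ,
           (_ ∷ _ ∷ a≢w ∷ _) ∷ _ ∷ (_ ∷ d≢e ∷ _) ∷ (_ ∷ w≢rest) ∷ _ ,
           _ ∷ _ ∷ _ ∷ w~e ∷ e~rest) | yes refl =
    entered-from rest (λ e≡d → d≢e (cong inj₁ (sym e≡d))) w~e (≢-sym a≢w) w≢rest e~rest
  noCycle (inj₂ a , inj₁ b ∷ inj₂ d ∷ rest , _ ,
           (_ ∷ a≢d ∷ _) ∷ _ , a~b ∷ b~d ∷ _) with b ≟ r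
  ... | no b≢r = a≢d (neighbour-unique {a = inj₂ a} b≢r a~b b~d)
  noCycle (inj₂ a , inj₁ b ∷ inj₂ d ∷ [] , _ , _ , _ ∷ _ ∷ () ∷ _) | yes refl
  noCycle (inj₂ a , inj₁ b ∷ inj₂ d ∷ inj₂ _ ∷ _ , _ , _ , _ ∷ _ ∷ () ∷ _) | yes refl
  noCycle (inj₂ a , inj₁ b ∷ inj₂ d ∷ inj₁ e ∷ rest , _ ,
           (_ ∷ a≢d ∷ _) ∷ (_ ∷ b≢e ∷ _) ∷ (_ ∷ d≢rest) ∷ _ , _ ∷ _ ∷ d~e ∷ e~rest) | yes refl =
    entered-from rest (λ e≡b → b≢e (cong inj₁ (sym e≡b))) d~e (≢-sym a≢d) d≢rest e~rest
  noCycle (inj₁ _ , inj₁ _ ∷ _ ∷ _ , _ , _ , () ∷ _)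
  noCycle (inj₁ _ , inj₂ _ ∷ inj₂ _ ∷ _ , _ , _ , _ ∷ () ∷ _)
  noCycle (inj₂ _ , inj₂ _ ∷ _ ∷ _ , _ , _ , () ∷ _)
  noCycle (inj₂ _ , inj₁ _ ∷ inj₁ _ ∷ _ , _ , _ , _ ∷ () ∷ _)

-- Root r is joined to every y in A, and each leaf x in L hangs from parent x ∈ A.
module DepthTwoTree {m n : ℕ} (c : Colouring m n) (i : Colour) (r : Fin m)
  {A : Pred (Fin n) 0ℓ} (A? : Decidable A) {L : Pred (Fin m) 0ℓ} (L? : Decidable L)
  (parent : Fin m → Fin n)
  (parent∈A : ∀ {x} → L x → A (parent x))
  (root-colour : ∀ {y} → A y → c r y ≡ i)
  (leaf-colour : ∀ {x} → L x → c x (parent x) ≡ i) where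

  Vert : V m n → Set
  Vert (inj₁ x) = x ≡ r ⊎ L x
  Vert (inj₂ y) = A y

  Vert? : Decidable Vert
  Vert? (inj₁ x) = (x ≟ r) ⊎-dec L? x
  Vert? (inj₂ y) = A? y

  Edge : Fin m → Fin n → Set
  Edge x y = (x ≡ r × A y) ⊎ (L x × parent x ≡ y)

  Edge? : ∀ x y → Dec (Edge x y)
  Edge? x y = ((x ≟ r) ×-dec A? y) ⊎-dec (L? x ×-dec (parent x ≟ y))

  edge⇒ends : ∀ {x y} → Edge x y → Vert (inj₁ x) × Vert (inj₂ y)
  edge⇒ends (inj₁ (refl , a)) = inj₁ refl , a
  edge⇒ends (inj₂ (l , refl)) = inj₂ l , parent∈A l

  tree : Subgraph m n
  tree = record
    { vert = λ v → ⌊ Vert? v ⌋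
    ; edge = λ x y → ⌊ Edge? x y ⌋
    ; edge-ok = λ x y e → let (u , w) = edge⇒ends (⌊⌋⇒witness (Edge? x y) e)
                          in witness⇒⌊⌋ (Vert? (inj₁ x)) u , witness⇒⌊⌋ (Vert? (inj₂ y)) w
    }

  vertexᵗ : ∀ v → Vert v → InH tree v
  vertexᵗ v = witness⇒⌊⌋ (Vert? v)

  edgeᵗ : ∀ x y → Edge x y → edge tree x y ≡ true
  edgeᵗ x y = witness⇒⌊⌋ (Edge? x y)

  root-edge : ∀ y → InH tree (inj₂ y) → edge tree r y ≡ true
  root-edge y h = edgeᵗ r y (inj₁ (refl , ⌊⌋⇒witness (A? y) h))

  tree-colour : HasColour c i tree
  tree-colour x y e with ⌊⌋⇒witness (Edge? x y) e
  ... | inj₁ (refl , a) = root-colour a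
  ... | inj₂ (l , refl) = leaf-colour l

  leaf-edge : ∀ {x y} → x ≢ r → edge tree x y ≡ true → parent x ≡ y
  leaf-edge {x} {y} x≢r e with ⌊⌋⇒witness (Edge? x y) e
  ... | inj₁ (x≡r , _) = ⊥-elim (x≢r x≡r)
  ... | inj₂ (_ , parent≡y) = parent≡y

  tree-isTree : ∀ {d} → DiamLE tree d → IsTree tree
  tree-isTree diam =
    (inj₁ r , vertexᵗ (inj₁ r) (inj₁ refl)) , DiamLE⇒Connected tree diam , noCycle tree r one-neighbour
    where
    one-neighbour : ∀ {x y y'} → x ≢ r → edge tree x y ≡ true → edge tree x y' ≡ true → y ≡ y'
    one-neighbour x≢r e e' = trans (sym (leaf-edge x≢r e)) (leaf-edge x≢r e')

  monoTree : ∀ {d} → DiamLE tree d → MonoTree c i d tree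
  monoTree diam = tree-colour , tree-isTree diam , diam

  to-root : ∀ u → InH tree u → Within tree 2 u (inj₁ r)
  to-root (inj₂ y) h = 1 , s≤s z≤n , cons (root-edge y h) nil
  to-root (inj₁ x) h with ⌊⌋⇒witness (Vert? (inj₁ x)) h
  ... | inj₁ refl = 0 , z≤n , nil
  ... | inj₂ l = 2 , ≤-refl ,
        cons {w = inj₂ (parent x)} (edgeᵗ x (parent x) (inj₂ (l , refl)))
          (cons (edgeᵗ r (parent x) (inj₁ (refl , parent∈A l))) nil)

  tree-diam4 : DiamLE tree 4
  tree-diam4 = radius⇒diam tree (inj₁ r) 2 to-root

  module _ {y₀ : Fin n} (a₀ : A y₀) (hang : ∀ {x} → L x → parent x ≡ y₀) where

    to-y₀ : ∀ x → InH tree (inj₁ x) → edge tree x y₀ ≡ true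
    to-y₀ x h with ⌊⌋⇒witness (Vert? (inj₁ x)) h
    ... | inj₁ refl = edgeᵗ r y₀ (inj₁ (refl , a₀))
    ... | inj₂ l = edgeᵗ x y₀ (inj₂ (l , hang l))

    tree-diam3 : DiamLE tree 3
    tree-diam3 = doubleStar⇒diam3 tree r y₀ (edgeᵗ r y₀ (inj₁ (refl , a₀))) to-y₀ root-edge

    tree-diam2-single : (∀ {y} → A y → y ≡ y₀) → DiamLE tree 2
    tree-diam2-single only-y₀ = radius⇒diam tree (inj₂ y₀) 1 to-centre
      where
      to-centre : ∀ u → InH tree u → Within tree 1 u (inj₂ y₀)
      to-centre (inj₁ x) h = 1 , ≤-refl , cons (to-y₀ x h) nil
      to-centre (inj₂ y) h with only-y₀ (⌊⌋⇒witness (A? y) h)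
      ... | refl = 0 , z≤n , nil

  tree-diam2-leafless : (∀ x → ¬ L x) → DiamLE tree 2
  tree-diam2-leafless no-leaf = radius⇒diam tree (inj₁ r) 1 to-centre
    where
    to-centre : ∀ u → InH tree u → Within tree 1 u (inj₁ r)
    to-centre (inj₂ y) h = 1 , ≤-refl , cons (root-edge y h) nil
    to-centre (inj₁ x) h with ⌊⌋⇒witness (Vert? (inj₁ x)) h
    ... | inj₁ refl = 0 , z≤n , nil
    ... | inj₂ l = ⊥-elim (no-leaf x l)

module _ {m n : ℕ} (c : Colouring m n) where

  P1-TreePair : Colour → Set
  P1-TreePair i = ∃₂ λ (T U : Subgraph m n) → MonoTree c i 3 T × MonoTree c (opp i) 2 U × Covers₂ T U

  monoRows⇒trees : ∀ {xa xb} i → (∀ y → c xa y ≡ i) → (∀ y → c xb y ≡ opp i) → Fin n → P1-TreePair i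
  monoRows⇒trees {xa} {xb} i row-i row-opp y₀ =
    T.tree , U.tree , T.monoTree (T.tree-diam3 tt (λ _ → refl)) ,
    U.monoTree (U.tree-diam2-single refl (λ _ → refl) id) , cover
    where
    module T = DepthTwoTree c i xa (λ _ → yes tt) (λ x → c x y₀ ≟ i) (const y₀)
                 (λ _ → tt) (λ _ → row-i _) id
    module U = DepthTwoTree c (opp i) xb (_≟ y₀) (λ x → c x y₀ ≟ opp i) (const y₀)
                 (λ _ → refl) (λ _ → row-opp _) id
    cover : Covers₂ T.tree U.tree
    cover (inj₂ y) = inj₁ (T.vertexᵗ (inj₂ y) tt)
    cover (inj₁ x) with ≡⊎≡opp (c x y₀) i
    ... | inj₁ e = inj₁ (T.vertexᵗ (inj₁ x) (inj₂ e))
    ... | inj₂ e = inj₂ (U.vertexᵗ (inj₁ x) (inj₂ e))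

  monoColumn⇒trees : ∀ {y₀} i → (∀ x → c x y₀ ≡ i) → Fin m → P1-TreePair i
  monoColumn⇒trees {y₀} i column-i x₀ =
    T.tree , U.tree , T.monoTree (T.tree-diam3 (column-i x₀) (λ _ → refl)) ,
    U.monoTree (U.tree-diam2-leafless λ _ ()) , cover
    where
    module T = DepthTwoTree c i x₀ (λ y → c x₀ y ≟ i) (λ _ → yes tt) (const y₀)
                 (λ _ → column-i x₀) id (λ _ → column-i _)
    module U = DepthTwoTree c (opp i) x₀ (λ y → c x₀ y ≟ opp i) (λ _ → ⊥-dec) (const y₀)
                 (λ ()) id (λ ())
    cover : Covers₂ T.tree U.tree
    cover (inj₁ x) = inj₁ (T.vertexᵗ (inj₁ x) (inj₂ tt))
    cover (inj₂ y) with ≡⊎≡opp (c x₀ y) i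
    ... | inj₁ e = inj₁ (T.vertexᵗ (inj₂ y) e)
    ... | inj₂ e = inj₂ (U.vertexᵗ (inj₂ y) e)

  P1⇒trees : P1 c → Fin m → Fin n → ∀ i → P1-TreePair i
  P1⇒trees (inj₁ (x₁ , x₂ , row₁ , row₂)) _ y₀ zero = monoRows⇒trees c₁ row₁ row₂ y₀
  P1⇒trees (inj₁ (x₁ , x₂ , row₁ , row₂)) _ y₀ (suc zero) = monoRows⇒trees c₂ row₂ row₁ y₀
  P1⇒trees (inj₂ (y₁ , y₂ , col₁ , col₂)) x₀ _ zero = monoColumn⇒trees c₁ col₁ x₀
  P1⇒trees (inj₂ (y₁ , y₂ , col₁ , col₂)) x₀ _ (suc zero) = monoColumn⇒trees c₂ col₂ x₀

  spanningDoubleStar : ∀ (i : Colour) {P : Pred (Fin m) 0ℓ} (P? : Decidable P)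
    {Q : Pred (Fin n) 0ℓ} (Q? : Decidable Q) →
    (∀ {x y} → P x → Q y → c x y ≡ i) → ∃ P → ∃ Q →
    ∃ λ T → MonoTree c i 3 T × (∀ {x} → P x → InH T (inj₁ x)) × (∀ {y} → Q y → InH T (inj₂ y))
  spanningDoubleStar i P? Q? mono (x₀ , p₀) (y₀ , q₀) =
    T.tree , T.monoTree (T.tree-diam3 q₀ (λ _ → refl)) ,
    (λ p → T.vertexᵗ (inj₁ _) (inj₂ p)) , T.vertexᵗ (inj₂ _)
    where
    module T = DepthTwoTree c i x₀ Q? P? (const y₀) (λ _ → q₀) (mono p₀) (λ p → mono p q₀)

-- The Y-part joined to X-part j by colour i in (P2).
matched : Colour → Fin 2 → Fin 2
matched zero j = j
matched (suc zero) j = opp j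

matched-involutive : ∀ i j → matched i (matched i j) ≡ j
matched-involutive zero _ = refl
matched-involutive (suc zero) zero = refl
matched-involutive (suc zero) (suc zero) = refl

module _ {m n : ℕ} (c : Colouring m n) where

  P2⇒trees : P2 c → ∀ i → ∃₂ λ (T U : Subgraph m n) → MonoTree c i 3 T × MonoTree c i 3 U × Covers₂ T U
  P2⇒trees (px , py , onto-x , onto-y , iff₁ , iff₂) i
    with block zero | block (suc zero)
    where
    colour-of-block : ∀ i {x y} → py y ≡ matched i (px x) → c x y ≡ i
    colour-of-block zero {x} {y} e = proj₂ (iff₁ x y) (sym e)
    colour-of-block (suc zero) {x} {y} e = proj₂ (iff₂ x y) (λ eq → opp-≢ (px x) (trans (sym e) (sym eq)))
    block : ∀ j → ∃ λ T → MonoTree c i 3 T × (∀ {x} → px x ≡ j → InH T (inj₁ x)) ×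
                                           (∀ {y} → py y ≡ matched i j → InH T (inj₂ y))
    block j = spanningDoubleStar c i (λ x → px x ≟ j) (λ y → py y ≟ matched i j)
                (λ p q → colour-of-block i (trans q (cong (matched i) (sym p))))
                (onto-x j) (onto-y (matched i j))
  ... | T₀ , mono₀ , inX₀ , inY₀ | T₁ , mono₁ , inX₁ , inY₁ = T₀ , T₁ , mono₀ , mono₁ , cover
    where
    in-own-block : ∀ y → py y ≡ matched i (matched i (py y))
    in-own-block y = sym (matched-involutive i (py y))
    cover : Covers₂ T₀ T₁
    cover (inj₁ x) with px x in eq
    ... | zero = inj₁ (inX₀ eq)
    ... | suc zero = inj₂ (inX₁ eq)
    cover (inj₂ y) with matched i (py y) in eq
    ... | zero = inj₁ (inY₀ (trans (in-own-block y) (cong (matched i) eq)))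
    ... | suc zero = inj₂ (inY₁ (trans (in-own-block y) (cong (matched i) eq)))

indicator : ∀ {p} {P : Set p} → Dec P → Fin 2
indicator (yes _) = zero
indicator (no _) = suc zero

indicator-yes : ∀ {p} {P : Set p} (P? : Dec P) → P → indicator P? ≡ zero
indicator-yes (yes _) _ = refl
indicator-yes (no ¬p) p = ⊥-elim (¬p p)

indicator-no : ∀ {p} {P : Set p} (P? : Dec P) → ¬ P → indicator P? ≡ suc zero
indicator-no (yes p) ¬p = ⊥-elim (¬p p)
indicator-no (no _) _ = refl

indicator-≡⇔ : ∀ {p q r} {P : Set p} {Q : Set q} {R : Set r} (P? : Dec P) (Q? : Dec Q) →
  (P → Q → R) → (¬ P → ¬ Q → R) → (P → ¬ Q → ¬ R) → (¬ P → Q → ¬ R) →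
  (R → indicator P? ≡ indicator Q?) × (indicator P? ≡ indicator Q? → R)
indicator-≡⇔ (yes p) (yes q) r₁ _ _ _ = const refl , const (r₁ p q)
indicator-≡⇔ (no ¬p) (no ¬q) _ r₂ _ _ = const refl , const (r₂ ¬p ¬q)
indicator-≡⇔ (yes p) (no ¬q) _ _ ¬r₁ _ = (λ r → ⊥-elim (¬r₁ p ¬q r)) , λ ()
indicator-≡⇔ (no ¬p) (yes q) _ _ _ ¬r₂ = (λ r → ⊥-elim (¬r₂ ¬p q r)) , λ ()

module _ {m n : ℕ} (c : Colouring m n) where

  Meet : Colour → Fin m → Fin m → Set
  Meet i x z = ∃ λ y → c x y ≡ i × c z y ≡ i

  meet? : ∀ i x z → Dec (Meet i x z)
  meet? i x z = any? (λ y → (c x y ≟ i) ×-dec (c z y ≟ i))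

  meet-sym : ∀ {i x z} → Meet i x z → Meet i z x
  meet-sym (y , e , e') = y , e' , e

  ¬meet⇒opp : ∀ {i x z y} → ¬ Meet i x z → c x y ≡ i → c z y ≡ opp i
  ¬meet⇒opp ¬meet e = ≢⇒≡opp (λ e' → ¬meet (_ , e , e'))

  Near : Colour → Fin m → Fin m → Set
  Near i x x' = Meet i x x' ⊎ ∃ λ z → Meet i x z × Meet i x' z

  near? : ∀ i x x' → Dec (Near i x x')
  near? i x x' = meet? i x x' ⊎-dec any? (λ z → meet? i x z ×-dec meet? i x' z)

  MonoRow : Colour → Fin m → Set
  MonoRow i x = ∀ y → c x y ≡ i

  RowsMeet : Colour → Set
  RowsMeet i = ∀ x → ∃ λ y → c x y ≡ i

  ¬monoRow⇒rowsMeet : ∀ {i} → ¬ ∃ (MonoRow (opp i)) → RowsMeet i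
  ¬monoRow⇒rowsMeet {i} ¬mono x with any? (λ y → c x y ≟ i)
  ... | yes meet = meet
  ... | no ¬meet = ⊥-elim (¬mono (x , λ y → ≢⇒≡opp (λ e → ¬meet (y , e))))

  ¬P1⇒rowsMeet : ¬ P1 c → RowsMeet c₁ ⊎ (∃ (MonoRow c₂) × RowsMeet c₂)
  ¬P1⇒rowsMeet ¬p1 with any? (λ x → all? (λ y → c x y ≟ c₂))
  ... | no ¬mono₂ = inj₁ (¬monoRow⇒rowsMeet ¬mono₂)
  ... | yes (x₂ , mono₂) =
    inj₂ ((x₂ , mono₂) , ¬monoRow⇒rowsMeet λ (x₁ , mono₁) → ¬p1 (inj₁ (x₁ , x₂ , mono₁ , mono₂)))

  -- (P2) for an arbitrary colour i in place of colour 1.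
  Bipartition : Colour → Set
  Bipartition i = Σ (Fin m → Fin 2) λ px → Σ (Fin n → Fin 2) λ py →
    (∀ (k : Fin 2) → ∃ λ x → px x ≡ k) × (∀ (k : Fin 2) → ∃ λ y → py y ≡ k) ×
    (∀ x y → (c x y ≡ i → px x ≡ py y) × (px x ≡ py y → c x y ≡ i))

  bipartition⇒P2 : Bipartition c₁ → P2 c
  bipartition⇒P2 (px , py , onto-x , onto-y , iff) = px , py , onto-x , onto-y , iff , iff₂
    where
    iff₂ : ∀ x y → (c x y ≡ c₂ → px x ≢ py y) × (px x ≢ py y → c x y ≡ c₂)
    iff₂ x y = (λ e eq → opp⇒≢ e (proj₂ (iff x y) eq)) , λ ne → ≢⇒≡opp (ne ∘ proj₁ (iff x y))

  blocks⇒bipartition : ∀ {i} {P : Pred (Fin m) 0ℓ} {Q : Pred (Fin n) 0ℓ} → Decidable P → Decidable Q →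
    ∃ P → ∃ (¬_ ∘ P) → ∃ Q → ∃ (¬_ ∘ Q) →
    (∀ {x y} → P x → Q y → c x y ≡ i) → (∀ {x y} → ¬ P x → ¬ Q y → c x y ≡ i) →
    (∀ {x y} → P x → ¬ Q y → c x y ≢ i) → (∀ {x y} → ¬ P x → Q y → c x y ≢ i) →
    Bipartition i
  blocks⇒bipartition P? Q? (x₀ , p₀) (x₁ , ¬p₁) (y₀ , q₀) (y₁ , ¬q₁) same same' cross cross' =
    indicator ∘ P? , indicator ∘ Q? , onto-x , onto-y ,
    λ x y → indicator-≡⇔ (P? x) (Q? y) same same' cross cross'
    where
    onto-x : ∀ k → ∃ λ x → indicator (P? x) ≡ k
    onto-x zero = x₀ , indicator-yes (P? x₀) p₀
    onto-x (suc zero) = x₁ , indicator-no (P? x₁) ¬p₁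
    onto-y : ∀ k → ∃ λ y → indicator (Q? y) ≡ k
    onto-y zero = y₀ , indicator-yes (Q? y₀) q₀
    onto-y (suc zero) = y₁ , indicator-no (Q? y₁) ¬q₁

  G : Colour → Subgraph m n
  G = colourGraph c

  edgeᶜ : ∀ {i x y} → c x y ≡ i → edge (G i) x y ≡ true
  edgeᶜ {i} {x} {y} = witness⇒⌊⌋ (c x y ≟ i)

  Reach : Colour → V m n → V m n → Set
  Reach i = Within (G i) 3

  IsCentre : Colour → V m n → Set
  IsCentre i v = ∀ u → Reach i u v

  centre⇒diam6 : ∀ {i v} → IsCentre i v → DiamLE (G i) 6
  centre⇒diam6 {i} {v} centre = radius⇒diam (G i) v 3 (λ u _ → centre u)

  reach-yx : ∀ {i x y} → c x y ≡ i → Reach i (inj₂ y) (inj₁ x)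
  reach-yx e = 1 , s≤s z≤n , cons (edgeᶜ e) nil

  reach-xyx : ∀ {i x y x'} → c x y ≡ i → c x' y ≡ i → Reach i (inj₁ x) (inj₁ x')
  reach-xyx {y = y} e e' = 2 , s≤s (s≤s z≤n) , cons {w = inj₂ y} (edgeᶜ e) (cons (edgeᶜ e') nil)

  reach-yxy : ∀ {i x y y'} → c x y ≡ i → c x y' ≡ i → Reach i (inj₂ y) (inj₂ y')
  reach-yxy {x = x} e e' = 2 , s≤s (s≤s z≤n) , cons {w = inj₁ x} (edgeᶜ e) (cons (edgeᶜ e') nil)

  reach-yxyx : ∀ {i x y y' x'} → c x y ≡ i → c x y' ≡ i → c x' y' ≡ i → Reach i (inj₂ y) (inj₁ x')
  reach-yxyx {x = x} {y' = y'} e e' e'' =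
    3 , ≤-refl , cons {w = inj₁ x} (edgeᶜ e) (cons {w = inj₂ y'} (edgeᶜ e') (cons (edgeᶜ e'') nil))

  reach-xyxy : ∀ {i x y x' y'} → c x y ≡ i → c x' y ≡ i → c x' y' ≡ i → Reach i (inj₁ x) (inj₂ y')
  reach-xyxy {y = y} {x' = x'} e e' e'' =
    3 , ≤-refl , cons {w = inj₂ y} (edgeᶜ e) (cons {w = inj₁ x'} (edgeᶜ e') (cons (edgeᶜ e'') nil))

  near⇒within4 : ∀ {i x x'} → Near i x x' → Within (G i) 4 (inj₁ x) (inj₁ x')
  near⇒within4 (inj₁ (y , e , e')) =
    2 , s≤s (s≤s z≤n) , cons {w = inj₂ y} (edgeᶜ e) (cons (edgeᶜ e') nil)
  near⇒within4 (inj₂ (z , (y , e₁ , e₂) , (y' , e₃ , e₄))) =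
    4 , ≤-refl , cons {w = inj₂ y} (edgeᶜ e₁) (cons {w = inj₁ z} (edgeᶜ e₂)
                   (cons {w = inj₂ y'} (edgeᶜ e₄) (cons (edgeᶜ e₃) nil)))

  monoRow⇒centre : ∀ {i x₀} → MonoRow i x₀ → RowsMeet i → IsCentre i (inj₁ x₀)
  monoRow⇒centre mono meets (inj₁ x) = let (y , e) = meets x in reach-xyx e (mono y)
  monoRow⇒centre mono meets (inj₂ y) = reach-yx (mono y)

module FarPair {m n : ℕ} (c : Colouring m n) (i : Colour) {x x' : Fin m}
  (¬common : ¬ Meet c i x x') (no-middle : ∀ {z} → Meet c i x z → ¬ Meet c i x' z) where

  ¬common' : ¬ Meet c i x' x
  ¬common' = ¬common ∘ meet-sym c

  no-middle' : ∀ {z} → Meet c i x' z → ¬ Meet c i x z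
  no-middle' m' m = no-middle m m'

  -- z ─ b₀ ─ z₀ if z meets x, else z ─ a₀ ─ z₀;  y ─ x ─ b₀ ─ z₀ or y ─ x' ─ a₀ ─ z₀.
  centre-meeting-neither : ∀ {z₀ a₀ b₀} → c x a₀ ≡ i → c x' b₀ ≡ i →
    ¬ Meet c i x z₀ → ¬ Meet c i x' z₀ → IsCentre c (opp i) (inj₁ z₀)
  centre-meeting-neither {z₀} xa₀ x'b₀ ¬m ¬m' (inj₁ z) with meet? c i x z
  ... | yes m = reach-xyx c (¬meet⇒opp c (no-middle m) x'b₀) (¬meet⇒opp c ¬m' x'b₀)
  ... | no ¬mz = reach-xyx c (¬meet⇒opp c ¬mz xa₀) (¬meet⇒opp c ¬m xa₀)
  centre-meeting-neither {z₀} xa₀ x'b₀ ¬m ¬m' (inj₂ y) with ≡⊎≡opp (c x y) i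
  ... | inj₂ xy = reach-yxyx c xy (¬meet⇒opp c ¬common' x'b₀) (¬meet⇒opp c ¬m' x'b₀)
  ... | inj₁ xy = reach-yxyx c (¬meet⇒opp c ¬common xy) (¬meet⇒opp c ¬common xa₀) (¬meet⇒opp c ¬m xa₀)

  -- y ─ x ─ ρ or y ─ x' ─ ρ;  z ─ b₀ ─ x ─ ρ if z meets x, else z ─ a₀ ─ x' ─ ρ.
  centre-opposite-to-both : ∀ {ρ a₀ b₀} → c x a₀ ≡ i → c x' b₀ ≡ i →
    c x ρ ≡ opp i → c x' ρ ≡ opp i → (∀ z → Meet c i x z ⊎ Meet c i x' z) → IsCentre c (opp i) (inj₂ ρ)
  centre-opposite-to-both xa₀ x'b₀ xρ x'ρ meets (inj₂ y) with ≡⊎≡opp (c x y) i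
  ... | inj₂ xy = reach-yxy c xy xρ
  ... | inj₁ xy = reach-yxy c (¬meet⇒opp c ¬common xy) x'ρ
  centre-opposite-to-both xa₀ x'b₀ xρ x'ρ meets (inj₁ z) with meets z
  ... | inj₁ m = reach-xyxy c (¬meet⇒opp c (no-middle m) x'b₀) (¬meet⇒opp c ¬common' x'b₀) xρ
  ... | inj₂ m' = reach-xyxy c (¬meet⇒opp c (no-middle' m') xa₀) (¬meet⇒opp c ¬common xa₀) x'ρ

  -- z ─ b₀ ─ s if z meets x, else z ─ a ─ s;  y ─ s if c x' y ≡ i, else y ─ x' ─ a ─ s.
  centre-meeting-x : ∀ {s a b₀} → c x' b₀ ≡ i →
    (∀ z → Meet c i x z ⊎ Meet c i x' z) → (∀ y → c x y ≡ i ⊎ c x' y ≡ i) →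
    Meet c i x s → c x a ≡ i → c s a ≡ opp i → IsCentre c (opp i) (inj₁ s)
  centre-meeting-x x'b₀ meets covers ms xa sa (inj₁ z) with meets z
  ... | inj₁ m = reach-xyx c (¬meet⇒opp c (no-middle m) x'b₀) (¬meet⇒opp c (no-middle ms) x'b₀)
  ... | inj₂ m' = reach-xyx c (¬meet⇒opp c (no-middle' m') xa) sa
  centre-meeting-x x'b₀ meets covers ms xa sa (inj₂ y) with covers y
  ... | inj₂ x'y = reach-yx c (¬meet⇒opp c (no-middle ms) x'y)
  ... | inj₁ xy = reach-yxyx c (¬meet⇒opp c ¬common xy) (¬meet⇒opp c ¬common xa) sa

module FarOutcome {m n : ℕ} (c : Colouring m n) (i : Colour) {x x' : Fin m} (far : ¬ Near c i x x')
  {a₀ b₀ : Fin n} (xa₀ : c x a₀ ≡ i) (x'b₀ : c x' b₀ ≡ i) where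

  private
    ¬common : ¬ Meet c i x x'
    ¬common = far ∘ inj₁
    no-middle : ∀ {z} → Meet c i x z → ¬ Meet c i x' z
    no-middle m m' = far (inj₂ (_ , m , m'))
    module F = FarPair c i ¬common no-middle
    module F' = FarPair c i F.¬common' F.no-middle'

  BipartitionOrCentre : Set
  BipartitionOrCentre = Bipartition c i ⊎ ∃ (IsCentre c (opp i))

  outcome-covered : (∀ z → Meet c i x z ⊎ Meet c i x' z) → (∀ y → c x y ≡ i ⊎ c x' y ≡ i) → BipartitionOrCentre
  outcome-covered meets covers
    with any? (λ s → meet? c i x s ×-dec any? (λ a → (c x a ≟ i) ×-dec (c s a ≟ opp i)))
  ... | yes (_ , ms , _ , xa , sa) = inj₂ (_ , F.centre-meeting-x x'b₀ meets covers ms xa sa)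
  ... | no ¬mixed with any? (λ s → meet? c i x' s ×-dec any? (λ a → (c x' a ≟ i) ×-dec (c s a ≟ opp i)))
  ...   | yes (_ , ms , _ , xa , sa) =
          inj₂ (_ , F'.centre-meeting-x xa₀ (swap ∘ meets) (swap ∘ covers) ms xa sa)
  ...   | no ¬mixed' =
          inj₁ (blocks⇒bipartition c (meet? c i x) (λ y → c x y ≟ i)
                  (x , a₀ , xa₀ , xa₀) (x' , ¬common) (a₀ , xa₀) (b₀ , λ e → ¬common (b₀ , e , x'b₀))
                  same same' cross cross')
    where
    meets-x' : ∀ {z} → ¬ Meet c i x z → Meet c i x' z
    meets-x' ¬m = [ ⊥-elim ∘ ¬m , id ]′ (meets _)
    x'-neighbour : ∀ {y} → c x y ≢ i → c x' y ≡ i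
    x'-neighbour ne = [ ⊥-elim ∘ ne , id ]′ (covers _)
    same : ∀ {z y} → Meet c i x z → c x y ≡ i → c z y ≡ i
    same m e = ≢opp⇒≡ λ e' → ¬mixed (_ , m , _ , e , e')
    same' : ∀ {z y} → ¬ Meet c i x z → c x y ≢ i → c z y ≡ i
    same' ¬m ne = ≢opp⇒≡ λ e' → ¬mixed' (_ , meets-x' ¬m , _ , x'-neighbour ne , e')
    cross : ∀ {z y} → Meet c i x z → c x y ≢ i → c z y ≢ i
    cross m ne = opp⇒≢ (¬meet⇒opp c (no-middle m) (x'-neighbour ne))
    cross' : ∀ {z y} → ¬ Meet c i x z → c x y ≡ i → c z y ≢ i
    cross' ¬m e = opp⇒≢ (¬meet⇒opp c (F.no-middle' (meets-x' ¬m)) e)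

  ¬neither⇒meets : ¬ (∃ λ z → ¬ Meet c i x z × ¬ Meet c i x' z) → ∀ z → Meet c i x z ⊎ Meet c i x' z
  ¬neither⇒meets ¬neither z = dec-⊎ (meet? c i x z) (meet? c i x' z) (λ (¬m , ¬m') → ¬neither (z , ¬m , ¬m'))

  outcome : BipartitionOrCentre
  outcome with any? (λ z → ¬? (meet? c i x z) ×-dec ¬? (meet? c i x' z))
  ... | yes (_ , ¬m , ¬m') = inj₂ (_ , F.centre-meeting-neither xa₀ x'b₀ ¬m ¬m')
  ... | no ¬neither with any? (λ y → (c x y ≟ opp i) ×-dec (c x' y ≟ opp i))
  ...   | yes (_ , xρ , x'ρ) = inj₂ (_ , F.centre-opposite-to-both xa₀ x'b₀ xρ x'ρ (¬neither⇒meets ¬neither))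
  ...   | no ¬both-opp = outcome-covered (¬neither⇒meets ¬neither) covers
    where
    covers : ∀ y → c x y ≡ i ⊎ c x' y ≡ i
    covers y = dec-⊎ (c x y ≟ i) (c x' y ≟ i) (λ (ne , ne') → ¬both-opp (y , ≢⇒≡opp ne , ≢⇒≡opp ne'))

transpose : ∀ {m n} → Colouring m n → Colouring n m
transpose c y x = c x y

flipᵛ : ∀ {m n} → V m n → V n m
flipᵛ (inj₁ x) = inj₂ x
flipᵛ (inj₂ y) = inj₁ y

module _ {m n : ℕ} (c : Colouring m n) where

  P1ᵀ⇒P1 : P1 (transpose c) → P1 c
  P1ᵀ⇒P1 = swap

  walkᵀ : ∀ {i u v k} → Walk (G (transpose c) i) u v k → Walk (G c i) (flipᵛ u) (flipᵛ v) k
  walkᵀ nil = nil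
  walkᵀ (cons {u = inj₁ _} {w = inj₂ _} a p) = cons a (walkᵀ p)
  walkᵀ (cons {u = inj₂ _} {w = inj₁ _} a p) = cons a (walkᵀ p)
  walkᵀ (cons {u = inj₁ _} {w = inj₁ _} () _)
  walkᵀ (cons {u = inj₂ _} {w = inj₂ _} () _)

  withinᵀ : ∀ {i d u v} → Within (G (transpose c) i) d u v → Within (G c i) d (flipᵛ u) (flipᵛ v)
  withinᵀ (k , k≤d , p) = k , k≤d , walkᵀ p

  centreᵀ : ∀ {i v} → IsCentre (transpose c) i v → IsCentre c i (flipᵛ v)
  centreᵀ centre (inj₁ x) = withinᵀ (centre (inj₂ x))
  centreᵀ centre (inj₂ y) = withinᵀ (centre (inj₁ y))

  bipartitionᵀ : ∀ {i} → Bipartition (transpose c) i → Bipartition c i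
  bipartitionᵀ (py , px , onto-y , onto-x , iff) =
    px , py , onto-x , onto-y , λ x y → (sym ∘ proj₁ (iff y x)) , (proj₂ (iff y x) ∘ sym)

  BipartitionOrDiam6 : Set
  BipartitionOrDiam6 = Bipartition c c₁ ⊎ ∃ λ i → DiamLE (G c i) 6

  module _ (nearX : ∀ x x' → Near c c₁ x x') (nearY : ∀ y y' → Near (transpose c) c₁ y y')
           (cols : RowsMeet (transpose c) c₁) where

    allNear-x-to-y : ∀ x y → Within (G c c₁) 6 (inj₁ x) (inj₂ y)
    allNear-x-to-y x y = let (x'' , e) = cols y in
      Within-weaken (m≤m+n 5 1) (Within-snoc (near⇒within4 c (nearX x x'')) (edgeᶜ c e))

    allNear⇒diam6 : DiamLE (G c c₁) 6
    allNear⇒diam6 (inj₁ x) (inj₁ x') _ _ = Within-weaken (m≤m+n 4 2) (near⇒within4 c (nearX x x'))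
    allNear⇒diam6 (inj₂ y) (inj₂ y') _ _ =
      Within-weaken (m≤m+n 4 2) (withinᵀ (near⇒within4 (transpose c) (nearY y y')))
    allNear⇒diam6 (inj₁ x) (inj₂ y) _ _ = allNear-x-to-y x y
    allNear⇒diam6 (inj₂ y) (inj₁ x) _ _ = Within-sym (allNear-x-to-y x y)

module _ {m n : ℕ} (c : Colouring m n) where

  far⇒outcome : ∀ {i} → RowsMeet c i → ¬ (∀ x x' → Near c i x x') →
    Bipartition c i ⊎ ∃ (IsCentre c (opp i))
  far⇒outcome {i} meets ¬allNear with ¬∀⟶∃¬ m _ (λ x → all? (near? c i x)) ¬allNear
  ... | x , ¬nearx with ¬∀⟶∃¬ m _ (near? c i x) ¬nearx
  ...   | x' , far = FarOutcome.outcome c i far (proj₂ (meets x)) (proj₂ (meets x'))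

module _ {m n : ℕ} (c : Colouring m n) where

  ¬P1⇒outcome : ¬ P1 c → BipartitionOrDiam6 c
  ¬P1⇒outcome ¬p1 with ¬P1⇒rowsMeet c ¬p1 | ¬P1⇒rowsMeet (transpose c) (¬p1 ∘ P1ᵀ⇒P1 c)
  ... | inj₂ ((_ , mono) , meets) | _ = inj₂ (c₂ , centre⇒diam6 c (monoRow⇒centre c mono meets))
  ... | _ | inj₂ ((_ , mono) , meets) =
    inj₂ (c₂ , centre⇒diam6 c (centreᵀ c (monoRow⇒centre (transpose c) mono meets)))
  ... | inj₁ rows | inj₁ cols with all? (λ x → all? (near? c c₁ x)) | all? (λ y → all? (near? (transpose c) c₁ y))
  ...   | yes nearX | yes nearY = inj₂ (c₁ , allNear⇒diam6 c nearX nearY cols)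
  ...   | no ¬nearX | _ =
    [ inj₁ , (λ (_ , centre) → inj₂ (c₂ , centre⇒diam6 c centre)) ]′ (far⇒outcome c rows ¬nearX)
  ...   | _ | no ¬nearY =
    [ inj₁ ∘ bipartitionᵀ c , (λ (_ , centre) → inj₂ (c₂ , centre⇒diam6 c (centreᵀ c centre))) ]′
      (far⇒outcome (transpose c) cols ¬nearY)

witnessOr : ∀ {k} {P : Pred (Fin k) 0ℓ} → Fin k → Dec (∃ P) → Fin k
witnessOr _ (yes (y , _)) = y
witnessOr y₀ (no _) = y₀

witnessOr-sound : ∀ {k} {P : Pred (Fin k) 0ℓ} (y₀ : Fin k) (P? : Dec (∃ P)) → ∃ P → P (witnessOr y₀ P?)
witnessOr-sound _ (yes (_ , p)) _ = p
witnessOr-sound _ (no ¬p) p = ⊥-elim (¬p p)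

-- The breadth-first tree of depth two in G_i rooted at r; y₀ is a junk parent for
-- vertices outside the tree.
module Ball₂ {m n : ℕ} (c : Colouring m n) (i : Colour) (r : Fin m) (y₀ : Fin n) where

  parent : Fin m → Fin n
  parent x = witnessOr y₀ (meet? c i r x)

  open DepthTwoTree c i r (λ y → c r y ≟ i) (meet? c i r) parent
    (λ m → proj₁ (witnessOr-sound y₀ (meet? c i r _) m)) id
    (λ m → proj₂ (witnessOr-sound y₀ (meet? c i r _) m))
    public using (tree; tree-diam4; monoTree; vertexᵗ)

module _ {m n : ℕ} (c : Colouring m n) where

  TwoTreeCover₄ : Set
  TwoTreeCover₄ = ∃₂ λ (i j : Colour) → ∃₂ λ (T U : Subgraph m n) →
    MonoTree c i 4 T × MonoTree c j 4 U × Covers₂ T U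

  agreeing⇒trees : ∀ {x₀} → Fin n → (∀ x → ∃ λ y → c x y ≡ c x₀ y) → TwoTreeCover₄
  agreeing⇒trees {x₀} y₀ agree =
    c₁ , c₂ , B₁.tree , B₂.tree , B₁.monoTree B₁.tree-diam4 , B₂.monoTree B₂.tree-diam4 , cover
    where
    module B₁ = Ball₂ c c₁ x₀ y₀
    module B₂ = Ball₂ c c₂ x₀ y₀
    cover : Covers₂ B₁.tree B₂.tree
    cover (inj₁ x) with agree x
    ... | y , e with ≡⊎≡opp (c x₀ y) c₁
    ...   | inj₁ e₁ = inj₁ (B₁.vertexᵗ (inj₁ x) (inj₂ (y , e₁ , trans e e₁)))
    ...   | inj₂ e₂ = inj₂ (B₂.vertexᵗ (inj₁ x) (inj₂ (y , e₂ , trans e e₂)))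
    cover (inj₂ y) with ≡⊎≡opp (c x₀ y) c₁
    ... | inj₁ e₁ = inj₁ (B₁.vertexᵗ (inj₂ y) e₁)
    ... | inj₂ e₂ = inj₂ (B₂.vertexᵗ (inj₂ y) e₂)

  complementary⇒trees : ∀ {i x₀ x₀'} → Fin n → (∀ y → c x₀' y ≢ c x₀ y) → RowsMeet c i → TwoTreeCover₄
  complementary⇒trees {i} {x₀} {x₀'} y₀ complement meets =
    i , i , B.tree , B'.tree , B.monoTree B.tree-diam4 , B'.monoTree B'.tree-diam4 , cover
    where
    module B = Ball₂ c i x₀ y₀
    module B' = Ball₂ c i x₀' y₀
    split : ∀ y → c x₀ y ≡ i ⊎ c x₀' y ≡ i
    split y with ≡⊎≡opp (c x₀ y) i
    ... | inj₁ e = inj₁ e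
    ... | inj₂ e = inj₂ (≢opp⇒≡ λ e' → complement y (trans e' (sym e)))
    cover : Covers₂ B.tree B'.tree
    cover (inj₂ y) = [ inj₁ ∘ B.vertexᵗ (inj₂ y) , inj₂ ∘ B'.vertexᵗ (inj₂ y) ]′ (split y)
    cover (inj₁ x) = let (y , e) = meets x in
      [ (λ e₀ → inj₁ (B.vertexᵗ (inj₁ x) (inj₂ (y , e₀ , e))))
      , (λ e₀ → inj₂ (B'.vertexᵗ (inj₁ x) (inj₂ (y , e₀ , e)))) ]′ (split y)

  ¬P1⇒trees : ¬ P1 c → Fin m → Fin n → TwoTreeCover₄
  ¬P1⇒trees ¬p1 x₀ y₀ with all? (λ x → any? (λ y → c x y ≟ c x₀ y))
  ... | yes agree = agreeing⇒trees y₀ agree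
  ... | no ¬agree with ¬∀⟶∃¬ m _ (λ x → any? (λ y → c x y ≟ c x₀ y)) ¬agree
  ...   | x₀' , ¬agree' =
    [ complementary⇒trees y₀ complement , complementary⇒trees y₀ complement ∘ proj₂ ]′ (¬P1⇒rowsMeet c ¬p1)
    where
    complement : ∀ y → c x₀' y ≢ c x₀ y
    complement y e = ¬agree' (y , e)

P1? : ∀ {m n} (c : Colouring m n) → Dec (P1 c)
P1? c = any? (λ x₁ → any? (λ x₂ → all? (λ y → c x₁ y ≟ c₁) ×-dec all? (λ y → c x₂ y ≟ c₂)))
  ⊎-dec any? (λ y₁ → any? (λ y₂ → all? (λ x → c x y₁ ≟ c₁) ×-dec all? (λ x → c x y₂ ≟ c₂)))

lemma4p18 : ∀ {m n} → 1 ≤ m → 1 ≤ n → (c : Colouring m n) →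
  (P1 c × (∀ (i : Colour) → ∃₂ λ (T U : Subgraph m n) →
      MonoTree c i 3 T × MonoTree c (opp i) 2 U × Covers₂ T U))
  ⊎ (P2 c × (∀ (i : Colour) → ∃₂ λ (T U : Subgraph m n) →
      MonoTree c i 3 T × MonoTree c i 3 U × Covers₂ T U))
  ⊎ ((∃ λ (i : Colour) → DiamLE (colourGraph c i) 6) ×
      ((∃₂ λ (i : Colour) (T : Subgraph m n) → MonoTree c i 4 T × Covers₁ T)
       ⊎ (∃₂ λ (i j : Colour) → ∃₂ λ (T U : Subgraph m n) →
            MonoTree c i 4 T × MonoTree c j 4 U × Covers₂ T U)))
lemma4p18 {suc m} {suc n} (s≤s z≤n) (s≤s z≤n) c with P1? c
... | yes p1 = inj₁ (p1 , P1⇒trees c p1 zero zero)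
... | no ¬p1 with ¬P1⇒outcome c ¬p1
...   | inj₁ bipartition = let p2 = bipartition⇒P2 c bipartition in inj₂ (inj₁ (p2 , P2⇒trees c p2))
...   | inj₂ diam = inj₂ (inj₂ (diam , inj₂ (¬P1⇒trees c ¬p1 zero zero)))
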